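{- Let $h \in \mathbb{H}(\mathbb{Q})$, with $CF(h)=\{\gamma_i\}_{i=0}^n$. Suppose one can write $h$ as a fraction with denominator $q\in\mathbb{Z}[i]$. Then $|q|\ge 2^{n/2}$.
   Context: The Heisenberg group $\mathbb H=\mathbb C\times\mathbb R$ with law $(z,t)*(z',t')=(z+z',t+t'+2\operatorname{Im}(\overline z z'))$, gauge norm $\|(z,t)\|=\sqrt[4]{|z|^4+t^2}$; $\mathbb H(\mathbb Z)=\mathbb Z[i]\times\mathbb Z$ and $\mathbb H(\mathbb Q)$ the points with rational coordinates. $CF(h)$ is the sequence of continued fraction digits of $h$ with respect to a fundamental domain $K$ for $\mathbb H(\mathbb Z)$ of radius $\operatorname{rad}(K)=\sup_{k\in K}\|k\|\le\sqrt[4]{1/2}$, such as the unit cube $K_C=[-1/2,1/2)^3$ or the Dirichlet domain $K_D$: with $[h]=g$ iff $h\in g*K$ and $\iota(z,t)=\left(\frac{ -z}{|z|^2+it},\frac{ -t}{|z|^4+t^2}\right)$ the Koranyi inversion, $\gamma_0=[h]$, $h_0=\gamma_0^{ -1}*h$, $\gamma_{i+1}=[\iota h_i]$, $h_{i+1}=\gamma_{i+1}^{ -1}*\iota h_i$. "Writing $h$ as a fraction with denominator $q$" refers to the planar Siegel coordinates $h=(r/q,p/q)$ with $q,r,p\in\mathbb Z[i]$, where a point $(z,t)$ has planar Siegel coordinates $(u,v)=(z(1+i),|z|^2+it)$. -}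

module Defs where

open import Data.Nat using (ℕ; zero; suc)
open import Data.Integer as ℤ using (ℤ)
open import Data.Rational as ℚ using (ℚ; 0ℚ; 1ℚ; _+_; _*_; -_; _-_; _≤_; 1/_; ≢-nonZero)
open import Data.Rational.Properties using (_≟_)
open import Data.Fin using (Fin; inject₁; fromℕ) renaming (zero to fz; suc to fs)
open import Data.Product using (Σ; _×_; _,_; ∃)
open import Relation.Nullary using (¬_; yes; no)
open import Relation.Binary.PropositionalEquality using (_≡_)

-- Reciprocal on ℚ, extended by 1/0 := 0 (only ever used at nonzero arguments).
inv : ℚ → ℚ
inv p with p ≟ 0ℚ
... | yes _ = 0ℚ
... | no ne = 1/_ p {{≢-nonZero ne}}

-- A point (z , t) of the rational Heisenberg group ℍ(ℚ), z = x + i y.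
record HQ : Set where
  constructor hq
  field
    x : ℚ
    y : ℚ
    t : ℚ
open HQ public

-- A point of ℍ(ℤ) = ℤ[i] × ℤ, z = a + i b.
record HZ : Set where
  constructor hz
  field
    a : ℤ
    b : ℤ
    c : ℤ
open HZ public

embZ : HZ → HQ
embZ g = hq (a g ℚ./ 1) (b g ℚ./ 1) (c g ℚ./ 1)

2ℚ : ℚ
2ℚ = 1ℚ + 1ℚ

0H : HQ
0H = hq 0ℚ 0ℚ 0ℚ

-- Group law (z,t)*(z',t') = (z+z', t+t'+2 Im(conj z z')), Im(conj z z') = x y' - y x'.
_⋆_ : HQ → HQ → HQ
hq x₁ y₁ t₁ ⋆ hq x₂ y₂ t₂ =
  hq (x₁ + x₂) (y₁ + y₂) (t₁ + t₂ + 2ℚ * (x₁ * y₂ - y₁ * x₂))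

invH : HQ → HQ
invH (hq x₁ y₁ t₁) = hq (- x₁) (- y₁) (- t₁)

absSq : HQ → ℚ
absSq h = x h * x h + y h * y h

norm4 : HQ → ℚ
norm4 h = absSq h * absSq h + t h * t h

-- Koranyi inversion ι(z,t) = ( -z / (|z|² + i t) , -t / (|z|⁴ + t²) ).
-- With s = |z|², N = s² + t²:  -z/(s+it) = -(x+iy)(s-it)/N.
ι : HQ → HQ
ι h = hq (- ((x h * s + y h * t h) * invN))
         (- ((y h * s - x h * t h) * invN))
         (- (t h * invN))
  where
    s = absSq h
    invN = inv (norm4 h)

IsFundamentalDomain : (HQ → Set) → Set
IsFundamentalDomain K =
  (h : HQ) → Σ HZ λ g → K (invH (embZ g) ⋆ h) ×
                        ((g' : HZ) → K (invH (embZ g') ⋆ h) → g' ≡ g)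

-- rad(K) ≤ (1/2)^(1/4), i.e. ‖k‖⁴ ≤ 1/2 for all k ∈ K.
RadiusBound : (HQ → Set) → Set
RadiusBound K = (k : HQ) → K k → norm4 k ≤ 1/_ 2ℚ

-- CF(h) = {γ_i}_{i=0}^n w.r.t. K, witnessed by the remainders h_0 … h_n:
--   γ_0 = [h], h_0 = γ_0⁻¹ * h, γ_{i+1} = [ι h_i], h_{i+1} = γ_{i+1}⁻¹ * ι h_i,
--   where [w] = g iff w ∈ g * K, i.e. g⁻¹ * w ∈ K;
--   h_i ≠ 0 for i < n (so ι h_i is defined) and the expansion terminates with h_n = 0.
IsCF : (HQ → Set) → HQ → (n : ℕ) → (Fin (suc n) → HZ) → Set
IsCF K h n γ = Σ (Fin (suc n) → HQ) λ hs →
  (K (invH (embZ (γ fz)) ⋆ h) × hs fz ≡ invH (embZ (γ fz)) ⋆ h) ×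
  ((i : Fin n) → K (invH (embZ (γ (fs i))) ⋆ ι (hs (inject₁ i)))
               × hs (fs i) ≡ invH (embZ (γ (fs i))) ⋆ ι (hs (inject₁ i))) ×
  ((i : Fin n) → ¬ (hs (inject₁ i) ≡ 0H)) ×
  hs (fromℕ n) ≡ 0H

record GZ : Set where
  constructor gz
  field
    re : ℤ
    im : ℤ
open GZ public

record GQ : Set where
  constructor gq
  field
    reQ : ℚ
    imQ : ℚ
open GQ public

embGZ : GZ → GQ
embGZ w = gq (re w ℚ./ 1) (im w ℚ./ 1)

_·_ : GQ → GQ → GQ
gq a₁ b₁ · gq a₂ b₂ = gq (a₁ * a₂ - b₁ * b₂) (a₁ * b₂ + b₁ * a₂)

-- planar Siegel coordinates (u , v) = (z (1+i) , |z|² + i t)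
siegelU : HQ → GQ
siegelU h = gq (x h - y h) (x h + y h)

siegelV : HQ → GQ
siegelV h = gq (absSq h) (t h)

-- h = (r/q , p/q) in planar Siegel coordinates, q ≠ 0.
WrittenWithDenominator : HQ → GZ → Set
WrittenWithDenominator h q =
  ¬ (q ≡ gz (ℤ.+ 0) (ℤ.+ 0)) ×
  Σ GZ λ r → Σ GZ λ p →
    (embGZ q · siegelU h ≡ embGZ r) × (embGZ q · siegelV h ≡ embGZ p)

normSqZ : GZ → ℤ
normSqZ q = re q ℤ.* re q ℤ.+ im q ℤ.* im q

-- In planar Siegel coordinates (u , v) the translation by g⁻¹ ∈ ℍ(ℤ) is the integral affine map
-- (u , v) ↦ (u - u_g , v + conj v_g - u conj u_g), so it keeps the denominator q of h = (r/q , p/q),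
-- while the Koranyi inversion is (u , v) ↦ (-u/v , 1/v), which turns (r/q , p/q) into (-r/p , q/p).
-- Since p = q v, the new denominator has |p|² = |q|² ‖h‖⁴ ≤ |q|²/2 whenever h lies in K.
-- Each of the n continued fraction steps therefore at least halves |q|², and the last denominator
-- is a nonzero Gaussian integer, so |q|² ≥ 2ⁿ.
module Submission where

open import Defs
open import Data.Nat using (ℕ; suc; _^_)
open import Data.Fin using (Fin; toℕ; inject₁; fromℕ) renaming (zero to fz; suc to fs)
open import Data.Fin.Induction using (<-weakInduction)
open import Data.Fin.Properties using (toℕ-inject₁; toℕ-fromℕ)
open import Data.Integer as ℤ using (ℤ; +_)
import Data.Integer.Properties as ℤP
import Data.Integer.Tactic.RingSolver as ℤSolver
open import Data.Rational as ℚ using (ℚ; 0ℚ; 1ℚ; _+_; _*_; -_; _-_; _≤_; _<_; 1/_; toℚᵘ)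
open import Data.Rational.Properties as ℚP using (_≟_; toℚᵘ-injective; toℚᵘ-fromℚᵘ; +-*-commutativeRing)
import Data.Rational.Unnormalised as ℚᵘ
import Data.Rational.Unnormalised.Properties as ℚᵘP
open import Data.Empty using (⊥-elim)
open import Data.Product using (Σ; _×_; _,_; proj₁; proj₂)
open import Function using (_∘_)
open import Level using (0ℓ)
open import Relation.Binary.Definitions using (tri<; tri≈; tri>)
open import Relation.Binary.PropositionalEquality
open import Relation.Nullary using (yes; no; contradiction)
open import Relation.Nullary.Decidable.Core using (dec⇒maybe)
open import Tactic.RingSolver using (solve-∀)
import Tactic.RingSolver.Core.AlmostCommutativeRing as ACR

ringℚ : ACR.AlmostCommutativeRing 0ℓ 0ℓ
ringℚ = ACR.fromCommutativeRing +-*-commutativeRing (λ p → dec⇒maybe (0ℚ ≟ p))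

fromℤ : ℤ → ℚ
fromℤ a = a ℚ./ 1

toℚᵘ-fromℤ : ∀ a → toℚᵘ (fromℤ a) ℚᵘ.≃ ℚᵘ.mkℚᵘ a 0
toℚᵘ-fromℤ a = toℚᵘ-fromℚᵘ (ℚᵘ.mkℚᵘ a 0)

fromℤ-from-≃ᵘ : ∀ a {p} → ℚᵘ.mkℚᵘ a 0 ℚᵘ.≃ toℚᵘ p → fromℤ a ≡ p
fromℤ-from-≃ᵘ a a≃p = toℚᵘ-injective (ℚᵘP.≃-trans (toℚᵘ-fromℤ a) a≃p)

fromℤ-homo-+ : ∀ a b → fromℤ (a ℤ.+ b) ≡ fromℤ a + fromℤ b
fromℤ-homo-+ a b = fromℤ-from-≃ᵘ (a ℤ.+ b) (begin
  ℚᵘ.mkℚᵘ (a ℤ.+ b) 0                          ≈⟨ ℚᵘ.*≡* (numerators a b) ⟩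
  ℚᵘ.mkℚᵘ a 0 ℚᵘ.+ ℚᵘ.mkℚᵘ b 0                ≈⟨ ℚᵘP.+-cong (toℚᵘ-fromℤ a) (toℚᵘ-fromℤ b) ⟨
  toℚᵘ (fromℤ a) ℚᵘ.+ toℚᵘ (fromℤ b)          ≈⟨ ℚP.toℚᵘ-homo-+ (fromℤ a) (fromℤ b) ⟨
  toℚᵘ (fromℤ a + fromℤ b)                    ∎)
  where
  open ℚᵘP.≃-Reasoning
  numerators : ∀ a b → (a ℤ.+ b) ℤ.* + 1 ≡ (a ℤ.* + 1 ℤ.+ b ℤ.* + 1) ℤ.* + 1
  numerators = ℤSolver.solve-∀

fromℤ-homo-* : ∀ a b → fromℤ (a ℤ.* b) ≡ fromℤ a * fromℤ b
fromℤ-homo-* a b = fromℤ-from-≃ᵘ (a ℤ.* b) (begin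
  ℚᵘ.mkℚᵘ (a ℤ.* b) 0                          ≈⟨ ℚᵘ.*≡* refl ⟩
  ℚᵘ.mkℚᵘ a 0 ℚᵘ.* ℚᵘ.mkℚᵘ b 0                ≈⟨ ℚᵘP.*-cong (toℚᵘ-fromℤ a) (toℚᵘ-fromℤ b) ⟨
  toℚᵘ (fromℤ a) ℚᵘ.* toℚᵘ (fromℤ b)          ≈⟨ ℚP.toℚᵘ-homo-* (fromℤ a) (fromℤ b) ⟨
  toℚᵘ (fromℤ a * fromℤ b)                    ∎)
  where open ℚᵘP.≃-Reasoning

fromℤ-homo‿- : ∀ a → fromℤ (ℤ.- a) ≡ - fromℤ a
fromℤ-homo‿- a = fromℤ-from-≃ᵘ (ℤ.- a) (begin
  ℚᵘ.mkℚᵘ (ℤ.- a) 0        ≈⟨ ℚᵘ.*≡* refl ⟩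
  ℚᵘ.- ℚᵘ.mkℚᵘ a 0         ≈⟨ ℚᵘP.-‿cong (toℚᵘ-fromℤ a) ⟨
  ℚᵘ.- toℚᵘ (fromℤ a)      ≈⟨ ℚP.toℚᵘ-homo‿- (fromℤ a) ⟨
  toℚᵘ (- fromℤ a)         ∎)
  where open ℚᵘP.≃-Reasoning

fromℤ-homo-- : ∀ a b → fromℤ (a ℤ.- b) ≡ fromℤ a - fromℤ b
fromℤ-homo-- a b = trans (fromℤ-homo-+ a (ℤ.- b)) (cong (λ c → fromℤ a + c) (fromℤ-homo‿- b))

fromℤ-cancel-≤ : ∀ {a b} → fromℤ a ≤ fromℤ b → a ℤ.≤ b
fromℤ-cancel-≤ {a} {b} a≤b
  with ℚᵘ.*≤* a≤b′ ← ℚᵘP.≤-respʳ-≃ (toℚᵘ-fromℤ b) (ℚᵘP.≤-respˡ-≃ (toℚᵘ-fromℤ a) (ℚP.toℚᵘ-mono-≤ a≤b))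
  = subst₂ ℤ._≤_ (ℤP.*-identityʳ a) (ℤP.*-identityʳ b) a≤b′

fromℤ-injective : ∀ {a b} → fromℤ a ≡ fromℤ b → a ≡ b
fromℤ-injective a≡b = ℤP.≤-antisym (fromℤ-cancel-≤ (ℚP.≤-reflexive a≡b)) (fromℤ-cancel-≤ (ℚP.≤-reflexive (sym a≡b)))

square-pos : ∀ p → p ≢ 0ℚ → 0ℚ < p * p
square-pos p p≢0 with ℚP.<-cmp p 0ℚ
... | tri< p<0 _ _ = let instance _ = ℚ.negative p<0 in ℚP.positive⁻¹ (p * p) {{ℚP.neg*neg⇒pos p p}}
... | tri≈ _ p≡0 _ = contradiction p≡0 p≢0
... | tri> _ _ p>0 = let instance _ = ℚ.positive p>0 in ℚP.positive⁻¹ (p * p) {{ℚP.pos*pos⇒pos p p}}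

square-nonNeg : ∀ p → 0ℚ ≤ p * p
square-nonNeg p with p ≟ 0ℚ
... | yes refl = ℚP.≤-refl
... | no p≢0 = ℚP.<⇒≤ (square-pos p p≢0)

sumOfSquares-nonNeg : ∀ p q → 0ℚ ≤ p * p + q * q
sumOfSquares-nonNeg p q = ℚP.+-mono-≤ (square-nonNeg p) (square-nonNeg q)

sumOfSquares≡0⇒≡0 : ∀ p q → p * p + q * q ≡ 0ℚ → p ≡ 0ℚ
sumOfSquares≡0⇒≡0 p q sum≡0 with p ≟ 0ℚ
... | yes p≡0 = p≡0
... | no p≢0 = ⊥-elim (ℚP.<-irrefl (sym sum≡0) (ℚP.+-mono-<-≤ (square-pos p p≢0) (square-nonNeg q)))

sumOfSquares≡0 : ∀ p q → p * p + q * q ≡ 0ℚ → p ≡ 0ℚ × q ≡ 0ℚ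
sumOfSquares≡0 p q sum≡0 =
  sumOfSquares≡0⇒≡0 p q sum≡0 , sumOfSquares≡0⇒≡0 q p (trans (ℚP.+-comm (q * q) (p * p)) sum≡0)

*-inv-inverseʳ : ∀ p → p ≢ 0ℚ → p * inv p ≡ 1ℚ
*-inv-inverseʳ p p≢0 with p ≟ 0ℚ
... | yes p≡0 = contradiction p≡0 p≢0
... | no p≢0′ = ℚP.*-inverseʳ p {{ℚ.≢-nonZero p≢0′}}

n≤½⇒2*[y*n]≤y : ∀ {y n} → 0ℚ ≤ y → n ≤ 1/ 2ℚ → 2ℚ * (y * n) ≤ y
n≤½⇒2*[y*n]≤y {y} {n} 0≤y n≤½ = begin
  2ℚ * (y * n)      ≡⟨ reorder y n ⟩
  y * (2ℚ * n)      ≤⟨ ℚP.*-monoˡ-≤-nonNeg y {{ℚ.nonNegative 0≤y}} (ℚP.*-monoˡ-≤-nonNeg 2ℚ n≤½) ⟩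
  y * (2ℚ * 1/ 2ℚ)  ≡⟨⟩
  y * 1ℚ            ≡⟨ ℚP.*-identityʳ y ⟩
  y                 ∎
  where
  open ℚP.≤-Reasoning
  reorder : ∀ y n → 2ℚ * (y * n) ≡ y * (2ℚ * n)
  reorder = solve-∀ ringℚ

infixl 6 _+ᵍ_ _-ᵍ_

_+ᵍ_ _-ᵍ_ : GQ → GQ → GQ
gq a b +ᵍ gq c d = gq (a + c) (b + d)
gq a b -ᵍ gq c d = gq (a - c) (b - d)

negᵍ conjᵍ : GQ → GQ
negᵍ (gq a b) = gq (- a) (- b)
conjᵍ (gq a b) = gq a (- b)

0ᵍ 1ᵍ : GQ
0ᵍ = gq 0ℚ 0ℚ
1ᵍ = gq 1ℚ 0ℚ

normSqᵍ : GQ → ℚ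
normSqᵍ (gq a b) = a * a + b * b

·-assocᵍ : ∀ u v w → (u · v) · w ≡ u · (v · w)
·-assocᵍ (gq a b) (gq c d) (gq e f) = cong₂ gq (real a b c d e f) (imag a b c d e f)
  where
  real : ∀ a b c d e f → (a * c - b * d) * e - (a * d + b * c) * f ≡ a * (c * e - d * f) - b * (c * f + d * e)
  real = solve-∀ ringℚ
  imag : ∀ a b c d e f → (a * c - b * d) * f + (a * d + b * c) * e ≡ a * (c * f + d * e) + b * (c * e - d * f)
  imag = solve-∀ ringℚ

·-distribˡ-+ᵍ : ∀ u v w → u · (v +ᵍ w) ≡ u · v +ᵍ u · w
·-distribˡ-+ᵍ (gq a b) (gq c d) (gq e f) = cong₂ gq (real a b c d e f) (imag a b c d e f)
  where
  real : ∀ a b c d e f → a * (c + e) - b * (d + f) ≡ (a * c - b * d) + (a * e - b * f)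
  real = solve-∀ ringℚ
  imag : ∀ a b c d e f → a * (d + f) + b * (c + e) ≡ (a * d + b * c) + (a * f + b * e)
  imag = solve-∀ ringℚ

·-distribˡ--ᵍ : ∀ u v w → u · (v -ᵍ w) ≡ u · v -ᵍ u · w
·-distribˡ--ᵍ (gq a b) (gq c d) (gq e f) = cong₂ gq (real a b c d e f) (imag a b c d e f)
  where
  real : ∀ a b c d e f → a * (c - e) - b * (d - f) ≡ (a * c - b * d) - (a * e - b * f)
  real = solve-∀ ringℚ
  imag : ∀ a b c d e f → a * (d - f) + b * (c - e) ≡ (a * d + b * c) - (a * f + b * e)
  imag = solve-∀ ringℚ

neg-distribʳ-·ᵍ : ∀ u v → negᵍ (u · v) ≡ u · negᵍ v
neg-distribʳ-·ᵍ (gq a b) (gq c d) = cong₂ gq (real a b c d) (imag a b c d)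
  where
  real : ∀ a b c d → - (a * c - b * d) ≡ a * - c - b * - d
  real = solve-∀ ringℚ
  imag : ∀ a b c d → - (a * d + b * c) ≡ a * - d + b * - c
  imag = solve-∀ ringℚ

·-identityʳᵍ : ∀ u → u · 1ᵍ ≡ u
·-identityʳᵍ (gq a b) = cong₂ gq (real a b) (imag a b)
  where
  real : ∀ a b → a * 1ℚ - b * 0ℚ ≡ a
  real = solve-∀ ringℚ
  imag : ∀ a b → a * 0ℚ + b * 1ℚ ≡ b
  imag = solve-∀ ringℚ

·-zeroˡᵍ : ∀ u → 0ᵍ · u ≡ 0ᵍ
·-zeroˡᵍ (gq a b) = cong₂ gq (real a b) (imag a b)
  where
  real : ∀ a b → 0ℚ * a - 0ℚ * b ≡ 0ℚ
  real = solve-∀ ringℚ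
  imag : ∀ a b → 0ℚ * b + 0ℚ * a ≡ 0ℚ
  imag = solve-∀ ringℚ

normSqᵍ-· : ∀ u v → normSqᵍ (u · v) ≡ normSqᵍ u * normSqᵍ v
normSqᵍ-· (gq a b) (gq c d) = lagrange a b c d
  where
  lagrange : ∀ a b c d → (a * c - b * d) * (a * c - b * d) + (a * d + b * c) * (a * d + b * c)
                         ≡ (a * a + b * b) * (c * c + d * d)
  lagrange = solve-∀ ringℚ

normSqᵍ-nonNeg : ∀ u → 0ℚ ≤ normSqᵍ u
normSqᵍ-nonNeg (gq a b) = sumOfSquares-nonNeg a b

infixl 6 _+ᶻ_ _-ᶻ_
infixl 7 _·ᶻ_

_+ᶻ_ _-ᶻ_ _·ᶻ_ : GZ → GZ → GZ
gz a b +ᶻ gz c d = gz (a ℤ.+ c) (b ℤ.+ d)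
gz a b -ᶻ gz c d = gz (a ℤ.- c) (b ℤ.- d)
gz a b ·ᶻ gz c d = gz (a ℤ.* c ℤ.- b ℤ.* d) (a ℤ.* d ℤ.+ b ℤ.* c)

negᶻ conjᶻ : GZ → GZ
negᶻ (gz a b) = gz (ℤ.- a) (ℤ.- b)
conjᶻ (gz a b) = gz a (ℤ.- b)

0ᶻ : GZ
0ᶻ = gz (+ 0) (+ 0)

embGZ-+ : ∀ u v → embGZ (u +ᶻ v) ≡ embGZ u +ᵍ embGZ v
embGZ-+ (gz a b) (gz c d) = cong₂ gq (fromℤ-homo-+ a c) (fromℤ-homo-+ b d)

embGZ-- : ∀ u v → embGZ (u -ᶻ v) ≡ embGZ u -ᵍ embGZ v
embGZ-- (gz a b) (gz c d) = cong₂ gq (fromℤ-homo-- a c) (fromℤ-homo-- b d)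

embGZ-· : ∀ u v → embGZ (u ·ᶻ v) ≡ embGZ u · embGZ v
embGZ-· (gz a b) (gz c d) = cong₂ gq
  (trans (fromℤ-homo-- (a ℤ.* c) (b ℤ.* d)) (cong₂ _-_ (fromℤ-homo-* a c) (fromℤ-homo-* b d)))
  (trans (fromℤ-homo-+ (a ℤ.* d) (b ℤ.* c)) (cong₂ _+_ (fromℤ-homo-* a d) (fromℤ-homo-* b c)))

embGZ-neg : ∀ u → embGZ (negᶻ u) ≡ negᵍ (embGZ u)
embGZ-neg (gz a b) = cong₂ gq (fromℤ-homo‿- a) (fromℤ-homo‿- b)

embGZ-conj : ∀ u → embGZ (conjᶻ u) ≡ conjᵍ (embGZ u)
embGZ-conj (gz a b) = cong (gq (fromℤ a)) (fromℤ-homo‿- b)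

embGZ-injective : ∀ {u v} → embGZ u ≡ embGZ v → u ≡ v
embGZ-injective {gz a b} {gz c d} u≡v =
  cong₂ gz (fromℤ-injective (cong reQ u≡v)) (fromℤ-injective (cong imQ u≡v))

fromℤ-normSqZ : ∀ u → fromℤ (normSqZ u) ≡ normSqᵍ (embGZ u)
fromℤ-normSqZ (gz a b) =
  trans (fromℤ-homo-+ (a ℤ.* a) (b ℤ.* b)) (cong₂ _+_ (fromℤ-homo-* a a) (fromℤ-homo-* b b))

normSqZ-pos : ∀ u → u ≢ 0ᶻ → + 1 ℤ.≤ normSqZ u
normSqZ-pos u@(gz a b) u≢0 = ℤP.i<j⇒suc[i]≤j (ℤP.≤∧≢⇒< 0≤N 0≢N)
  where
  0≤N : + 0 ℤ.≤ normSqZ u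
  0≤N = fromℤ-cancel-≤ (subst (0ℚ ≤_) (sym (fromℤ-normSqZ u)) (normSqᵍ-nonNeg (embGZ u)))
  0≢N : + 0 ≢ normSqZ u
  0≢N 0≡N with sumOfSquares≡0 (fromℤ a) (fromℤ b) (trans (sym (fromℤ-normSqZ u)) (cong fromℤ (sym 0≡N)))
  ... | a≡0 , b≡0 = u≢0 (embGZ-injective (cong₂ gq a≡0 b≡0))

siegelU-translate : ∀ k h → siegelU (invH k ⋆ h) ≡ siegelU h -ᵍ siegelU k
siegelU-translate (hq c d s) (hq x y t) = cong₂ gq (real c d x y) (imag c d x y)
  where
  real : ∀ c d x y → (- c + x) - (- d + y) ≡ (x - y) - (c - d)
  real = solve-∀ ringℚ
  imag : ∀ c d x y → (- c + x) + (- d + y) ≡ (x + y) - (c + d)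
  imag = solve-∀ ringℚ

siegelV-translate : ∀ k h →
  siegelV (invH k ⋆ h) ≡ siegelV h +ᵍ conjᵍ (siegelV k) -ᵍ siegelU h · conjᵍ (siegelU k)
siegelV-translate (hq c d s) (hq x y t) = cong₂ gq (real c d x y) (imag c d s x y t)
  where
  real : ∀ c d x y → (- c + x) * (- c + x) + (- d + y) * (- d + y)
                         ≡ (x * x + y * y) + (c * c + d * d) - ((x - y) * (c - d) - (x + y) * - (c + d))
  real = solve-∀ ringℚ
  imag : ∀ c d s x y t → - s + t + 2ℚ * ((- c) * y - (- d) * x)
                         ≡ t + - s - ((x - y) * - (c + d) + (x + y) * (c - d))
  imag = solve-∀ ringℚ

siegelUᶻ siegelVᶻ : HZ → GZ
siegelUᶻ (hz a b c) = gz (a ℤ.- b) (a ℤ.+ b)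
siegelVᶻ (hz a b c) = gz (normSqZ (gz a b)) c

siegelU-embZ : ∀ g → siegelU (embZ g) ≡ embGZ (siegelUᶻ g)
siegelU-embZ (hz a b c) = sym (cong₂ gq (fromℤ-homo-- a b) (fromℤ-homo-+ a b))

siegelV-embZ : ∀ g → siegelV (embZ g) ≡ embGZ (siegelVᶻ g)
siegelV-embZ (hz a b c) = sym (cong₂ gq (fromℤ-normSqZ (gz a b)) refl)

norm4≡0⇒≡0H : ∀ h → norm4 h ≡ 0ℚ → h ≡ 0H
norm4≡0⇒≡0H (hq x y t) N≡0 with sumOfSquares≡0 (x * x + y * y) t N≡0
... | s≡0 , refl with sumOfSquares≡0 x y s≡0
... | refl , refl = refl

≡-modulo-0 : ∀ {a b e} w → e ≡ 0ℚ → a ≡ b + e * w → a ≡ b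
≡-modulo-0 {b = b} w refl a≡b+0 = trans a≡b+0 (trans (cong (λ c → b + c) (ℚP.*-zeroˡ w)) (ℚP.+-identityʳ b))

norm4*inv-1≡0 : ∀ h → h ≢ 0H → norm4 h * inv (norm4 h) - 1ℚ ≡ 0ℚ
norm4*inv-1≡0 h h≢0 =
  trans (cong (_- 1ℚ) (*-inv-inverseʳ (norm4 h) (h≢0 ∘ norm4≡0⇒≡0H h))) (ℚP.+-inverseʳ 1ℚ)

-- The ring solver cannot use N * (1/N) = 1 for N = norm4 h, so each component identity is proved
-- with an explicit multiple of N * (1/N) - 1 as error term.
siegelV-·-siegelU-ι : ∀ h → h ≢ 0H → siegelV h · siegelU (ι h) ≡ negᵍ (siegelU h)
siegelV-·-siegelU-ι h@(hq x y t) h≢0 = cong₂ gq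
  (≡-modulo-0 (- (x - y)) (norm4*inv-1≡0 h h≢0) (real x y t i))
  (≡-modulo-0 (- (x + y)) (norm4*inv-1≡0 h h≢0) (imag x y t i))
  where
  i = inv (norm4 h)
  real : ∀ x y t i → let s = x * x + y * y; X = - ((x * s + y * t) * i); Y = - ((y * s - x * t) * i) in
         s * (X - Y) - t * (X + Y) ≡ - (x - y) + ((s * s + t * t) * i - 1ℚ) * - (x - y)
  real = solve-∀ ringℚ
  imag : ∀ x y t i → let s = x * x + y * y; X = - ((x * s + y * t) * i); Y = - ((y * s - x * t) * i) in
         s * (X + Y) + t * (X - Y) ≡ - (x + y) + ((s * s + t * t) * i - 1ℚ) * - (x + y)
  imag = solve-∀ ringℚ

siegelV-·-siegelV-ι : ∀ h → h ≢ 0H → siegelV h · siegelV (ι h) ≡ 1ᵍ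
siegelV-·-siegelV-ι h@(hq x y t) h≢0 = cong₂ gq
  (≡-modulo-0 (1ℚ + i * s * s) (norm4*inv-1≡0 h h≢0) (real x y t i))
  (≡-modulo-0 (s * t * i) (norm4*inv-1≡0 h h≢0) (imag x y t i))
  where
  i = inv (norm4 h)
  s = x * x + y * y
  real : ∀ x y t i → let s = x * x + y * y; X = - ((x * s + y * t) * i); Y = - ((y * s - x * t) * i) in
         s * (X * X + Y * Y) - t * - (t * i) ≡ 1ℚ + ((s * s + t * t) * i - 1ℚ) * (1ℚ + i * s * s)
  real = solve-∀ ringℚ
  imag : ∀ x y t i → let s = x * x + y * y; X = - ((x * s + y * t) * i); Y = - ((y * s - x * t) * i) in
         s * - (t * i) + t * (X * X + Y * Y) ≡ 0ℚ + ((s * s + t * t) * i - 1ℚ) * (s * t * i)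
  imag = solve-∀ ringℚ

translate-denominator : ∀ g {h q} → WrittenWithDenominator h q → WrittenWithDenominator (invH (embZ g) ⋆ h) q
translate-denominator g {h} {q} (q≢0 , r , p , qu≡r , qv≡p) =
  q≢0 , r -ᶻ q ·ᶻ uᵍ , p +ᶻ q ·ᶻ conjᶻ vᵍ -ᶻ r ·ᶻ conjᶻ uᵍ , numerator-u , numerator-v
  where
  open ≡-Reasoning
  k = embZ g
  u = siegelU h
  v = siegelV h
  uₖ = siegelU k
  vₖ = siegelV k
  uᵍ = siegelUᶻ g
  vᵍ = siegelVᶻ g
  Q = embGZ q
  numerator-u : Q · siegelU (invH k ⋆ h) ≡ embGZ (r -ᶻ q ·ᶻ uᵍ)
  numerator-u = begin
    Q · siegelU (invH k ⋆ h)             ≡⟨ cong (Q ·_) (siegelU-translate k h) ⟩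
    Q · (u -ᵍ uₖ)                        ≡⟨ ·-distribˡ--ᵍ Q u uₖ ⟩
    Q · u -ᵍ Q · uₖ                      ≡⟨ cong₂ (λ a b → a -ᵍ Q · b) qu≡r (siegelU-embZ g) ⟩
    embGZ r -ᵍ Q · embGZ uᵍ              ≡⟨ cong (λ w → embGZ r -ᵍ w) (embGZ-· q uᵍ) ⟨
    embGZ r -ᵍ embGZ (q ·ᶻ uᵍ)           ≡⟨ embGZ-- r (q ·ᶻ uᵍ) ⟨
    embGZ (r -ᶻ q ·ᶻ uᵍ)                 ∎
  numerator-v : Q · siegelV (invH k ⋆ h) ≡ embGZ (p +ᶻ q ·ᶻ conjᶻ vᵍ -ᶻ r ·ᶻ conjᶻ uᵍ)
  numerator-v = begin
    Q · siegelV (invH k ⋆ h)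
      ≡⟨ cong (Q ·_) (siegelV-translate k h) ⟩
    Q · (v +ᵍ conjᵍ vₖ -ᵍ u · conjᵍ uₖ)
      ≡⟨ ·-distribˡ--ᵍ Q (v +ᵍ conjᵍ vₖ) (u · conjᵍ uₖ) ⟩
    Q · (v +ᵍ conjᵍ vₖ) -ᵍ Q · (u · conjᵍ uₖ)
      ≡⟨ cong₂ _-ᵍ_ (·-distribˡ-+ᵍ Q v (conjᵍ vₖ)) (sym (·-assocᵍ Q u (conjᵍ uₖ))) ⟩
    Q · v +ᵍ Q · conjᵍ vₖ -ᵍ (Q · u) · conjᵍ uₖ
      ≡⟨ cong₂ (λ a b → a +ᵍ Q · conjᵍ b -ᵍ (Q · u) · conjᵍ uₖ) qv≡p (siegelV-embZ g) ⟩
    embGZ p +ᵍ Q · conjᵍ (embGZ vᵍ) -ᵍ (Q · u) · conjᵍ uₖ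
      ≡⟨ cong₂ (λ a b → embGZ p +ᵍ Q · conjᵍ (embGZ vᵍ) -ᵍ a · conjᵍ b) qu≡r (siegelU-embZ g) ⟩
    embGZ p +ᵍ Q · conjᵍ (embGZ vᵍ) -ᵍ embGZ r · conjᵍ (embGZ uᵍ)
      ≡⟨ cong₂ (λ a b → embGZ p +ᵍ Q · a -ᵍ embGZ r · b) (embGZ-conj vᵍ) (embGZ-conj uᵍ) ⟨
    embGZ p +ᵍ Q · embGZ (conjᶻ vᵍ) -ᵍ embGZ r · embGZ (conjᶻ uᵍ)
      ≡⟨ cong₂ (λ a b → embGZ p +ᵍ a -ᵍ b) (embGZ-· q (conjᶻ vᵍ)) (embGZ-· r (conjᶻ uᵍ)) ⟨
    embGZ p +ᵍ embGZ (q ·ᶻ conjᶻ vᵍ) -ᵍ embGZ (r ·ᶻ conjᶻ uᵍ)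
      ≡⟨ cong (_-ᵍ embGZ (r ·ᶻ conjᶻ uᵍ)) (embGZ-+ p (q ·ᶻ conjᶻ vᵍ)) ⟨
    embGZ (p +ᶻ q ·ᶻ conjᶻ vᵍ) -ᵍ embGZ (r ·ᶻ conjᶻ uᵍ)
      ≡⟨ embGZ-- (p +ᶻ q ·ᶻ conjᶻ vᵍ) (r ·ᶻ conjᶻ uᵍ) ⟨
    embGZ (p +ᶻ q ·ᶻ conjᶻ vᵍ -ᶻ r ·ᶻ conjᶻ uᵍ)
      ∎

ι-denominator : ∀ {h q} → h ≢ 0H → WrittenWithDenominator h q →
  Σ GZ λ p → WrittenWithDenominator (ι h) p × normSqᵍ (embGZ p) ≡ normSqᵍ (embGZ q) * norm4 h
ι-denominator {h} {q} h≢0 (q≢0 , r , p , qu≡r , qv≡p) =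
  p , (p≢0 , negᶻ r , q , numerator-u , numerator-v) , norm-p
  where
  open ≡-Reasoning
  times-v : ∀ {w w′} → siegelV h · w ≡ w′ → embGZ p · w ≡ embGZ q · w′
  times-v {w} {w′} vw≡w′ = begin
    embGZ p · w                 ≡⟨ cong (_· w) qv≡p ⟨
    (embGZ q · siegelV h) · w   ≡⟨ ·-assocᵍ (embGZ q) (siegelV h) w ⟩
    embGZ q · (siegelV h · w)   ≡⟨ cong (embGZ q ·_) vw≡w′ ⟩
    embGZ q · w′                ∎
  numerator-u : embGZ p · siegelU (ι h) ≡ embGZ (negᶻ r)
  numerator-u = begin
    embGZ p · siegelU (ι h)      ≡⟨ times-v (siegelV-·-siegelU-ι h h≢0) ⟩
    embGZ q · negᵍ (siegelU h)   ≡⟨ neg-distribʳ-·ᵍ (embGZ q) (siegelU h) ⟨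
    negᵍ (embGZ q · siegelU h)   ≡⟨ cong negᵍ qu≡r ⟩
    negᵍ (embGZ r)               ≡⟨ embGZ-neg r ⟨
    embGZ (negᶻ r)               ∎
  numerator-v : embGZ p · siegelV (ι h) ≡ embGZ q
  numerator-v = trans (times-v (siegelV-·-siegelV-ι h h≢0)) (·-identityʳᵍ (embGZ q))
  p≢0 : p ≢ 0ᶻ
  p≢0 p≡0 = q≢0 (embGZ-injective (begin
    embGZ q                    ≡⟨ numerator-v ⟨
    embGZ p · siegelV (ι h)    ≡⟨ cong (λ w → embGZ w · siegelV (ι h)) p≡0 ⟩
    0ᵍ · siegelV (ι h)         ≡⟨ ·-zeroˡᵍ (siegelV (ι h)) ⟩
    0ᵍ                         ∎))
  norm-p : normSqᵍ (embGZ p) ≡ normSqᵍ (embGZ q) * norm4 h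
  norm-p = trans (cong normSqᵍ (sym qv≡p)) (normSqᵍ-· (embGZ q) (siegelV h))

normSq-halving : ∀ {h q p} → norm4 h ≤ 1/ 2ℚ → normSqᵍ (embGZ p) ≡ normSqᵍ (embGZ q) * norm4 h →
  + 2 ℤ.* normSqZ p ℤ.≤ normSqZ q
normSq-halving {h} {q} {p} h≤½ norm-p = fromℤ-cancel-≤ (begin
  fromℤ (+ 2 ℤ.* normSqZ p)            ≡⟨ fromℤ-homo-* (+ 2) (normSqZ p) ⟩
  2ℚ * fromℤ (normSqZ p)               ≡⟨ cong (2ℚ *_) (trans (fromℤ-normSqZ p) norm-p) ⟩
  2ℚ * (normSqᵍ (embGZ q) * norm4 h)   ≤⟨ n≤½⇒2*[y*n]≤y (normSqᵍ-nonNeg (embGZ q)) h≤½ ⟩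
  normSqᵍ (embGZ q)                    ≡⟨ fromℤ-normSqZ q ⟨
  fromℤ (normSqZ q)                    ∎)
  where open ℚP.≤-Reasoning

cf-step-denominator : ∀ {K} → RadiusBound K → ∀ h q → K h → h ≢ 0H → WrittenWithDenominator h q →
  ∀ g → Σ GZ λ p → WrittenWithDenominator (invH (embZ g) ⋆ ι h) p × + 2 ℤ.* normSqZ p ℤ.≤ normSqZ q
cf-step-denominator rad h q h∈K h≢0 h/q g =
  let p , ιh/p , norm-p = ι-denominator h≢0 h/q
  in p , translate-denominator g ιh/p , normSq-halving {h} {q} {p} (rad h h∈K) norm-p

2^[1+m]*x≡2^m*[2*x] : ∀ m x → + (2 ^ suc m) ℤ.* x ≡ + (2 ^ m) ℤ.* (+ 2 ℤ.* x)
2^[1+m]*x≡2^m*[2*x] m x = trans (cong (ℤ._* x) (ℤP.pos-* 2 (2 ^ m))) (reorder (+ (2 ^ m)) x)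
  where
  reorder : ∀ a x → (+ 2 ℤ.* a) ℤ.* x ≡ a ℤ.* (+ 2 ℤ.* x)
  reorder = ℤSolver.solve-∀

cf-remainder-denominator : ∀ {K} → RadiusBound K → ∀ h n γ (cf : IsCF K h n γ) →
  ∀ q → WrittenWithDenominator h q → ∀ j →
  Σ GZ λ qⱼ → WrittenWithDenominator (proj₁ cf j) qⱼ × + (2 ^ toℕ j) ℤ.* normSqZ qⱼ ℤ.≤ normSqZ q
cf-remainder-denominator {K} rad h n γ (hs , (h₀∈K , h₀≡) , steps , hᵢ≢0 , _) q h/q =
  <-weakInduction P base step
  where
  P : Fin (suc n) → Set
  P j = Σ GZ λ qⱼ → WrittenWithDenominator (hs j) qⱼ × + (2 ^ toℕ j) ℤ.* normSqZ qⱼ ℤ.≤ normSqZ q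
  remainder-in-K : ∀ j → K (hs j)
  remainder-in-K fz = subst K (sym h₀≡) h₀∈K
  remainder-in-K (fs i) = subst K (sym (proj₂ (steps i))) (proj₁ (steps i))
  base : P fz
  base = q , subst (λ x → WrittenWithDenominator x q) (sym h₀≡) (translate-denominator (γ fz) h/q) ,
         ℤP.≤-reflexive (ℤP.*-identityˡ (normSqZ q))
  step : ∀ i → P (inject₁ i) → P (fs i)
  step i (qᵢ , hᵢ/qᵢ , bound) =
    let p , hᵢ₊₁/p , 2p≤qᵢ =
          cf-step-denominator rad (hs (inject₁ i)) qᵢ (remainder-in-K (inject₁ i)) (hᵢ≢0 i) hᵢ/qᵢ (γ (fs i))
    in p , subst (λ x → WrittenWithDenominator x p) (sym (proj₂ (steps i))) hᵢ₊₁/p , (begin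
    + (2 ^ suc (toℕ i)) ℤ.* normSqZ p          ≡⟨ 2^[1+m]*x≡2^m*[2*x] (toℕ i) (normSqZ p) ⟩
    + (2 ^ toℕ i) ℤ.* (+ 2 ℤ.* normSqZ p)      ≤⟨ ℤP.*-monoˡ-≤-nonNeg (+ (2 ^ toℕ i)) 2p≤qᵢ ⟩
    + (2 ^ toℕ i) ℤ.* normSqZ qᵢ               ≡⟨ cong (λ m → + (2 ^ m) ℤ.* normSqZ qᵢ) (toℕ-inject₁ i) ⟨
    + (2 ^ toℕ (inject₁ i)) ℤ.* normSqZ qᵢ     ≤⟨ bound ⟩
    normSqZ q                                  ∎)
    where open ℤP.≤-Reasoning

theorem3p11 : (K : HQ → Set) → IsFundamentalDomain K → RadiusBound K →
    (h : HQ) (n : ℕ) (γ : Fin (suc n) → HZ) → IsCF K h n γ →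
    (q : GZ) → WrittenWithDenominator h q →
    + (2 ^ n) ℤ.≤ normSqZ q
theorem3p11 K _ rad h n γ cf q h/q =
  let qₙ , (qₙ≢0 , _) , bound = cf-remainder-denominator rad h n γ cf q h/q (fromℕ n)
  in begin
  + (2 ^ n)                              ≡⟨ ℤP.*-identityʳ (+ (2 ^ n)) ⟨
  + (2 ^ n) ℤ.* + 1                      ≤⟨ ℤP.*-monoˡ-≤-nonNeg (+ (2 ^ n)) (normSqZ-pos qₙ qₙ≢0) ⟩
  + (2 ^ n) ℤ.* normSqZ qₙ               ≡⟨ cong (λ m → + (2 ^ m) ℤ.* normSqZ qₙ) (toℕ-fromℕ n) ⟨
  + (2 ^ toℕ (fromℕ n)) ℤ.* normSqZ qₙ   ≤⟨ bound ⟩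
  normSqZ q                              ∎
  where open ℤP.≤-Reasoning
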